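{- Let $\Sigma$ be any subexponential signature, $\Pi$ a finite (possibly empty) sequence of $\mathrm{SMALC}_\Sigma$-formulae and $B$ an $\mathrm{SMALC}_\Sigma$-formula. The sequent $\Pi\to B$ is derivable in $\mathrm{SMALC}_\Sigma$ if and only if the sequent $\vdash\widehat\Pi^\bot,\widehat B$ is derivable in $\mathrm{SCLL}_\Sigma$.
   Context: A subexponential signature is a tuple $\Sigma = \langle \mathcal{I}, \preceq, \mathcal{W}, \mathcal{C}, \mathcal{E}\rangle$ where $\mathcal{I}$ is a finite set of labels, $\preceq$ is a preorder on $\mathcal{I}$, $\mathcal{W},\mathcal{C},\mathcal{E}\subseteq\mathcal{I}$ are upwardly closed with respect to $\preceq$, and $\mathcal{W}\cap\mathcal{C}\subseteq\mathcal{E}$. $\mathrm{SMALC}_\Sigma$ (cut-free): formulae from variables $p_i$ and $\mathbf{1}$ using $\cdot,\backslash,/,\wedge,\vee,{!}^s$ ($s\in\mathcal{I}$); sequents $\Gamma\to C$ with $\Gamma$ a finite possibly empty sequence. Rules: (ax) $A\to A$; ($\to\mathbf{1}$) $\to\mathbf{1}$; ($\cdot\to$) $\Gamma_1,A,B,\Gamma_2\to C\ /\ \Gamma_1,A\cdot B,\Gamma_2\to C$; ($\to\cdot$) $\Gamma_1\to A$, $\Gamma_2\to B\ /\ \Gamma_1,\Gamma_2\to A\cdot B$; ($\backslash\to$) $\Pi\to A$, $\Gamma_1,B,\Gamma_2\to C\ /\ \Gamma_1,\Pi,A\backslash B,\Gamma_2\to C$; ($\to\backslash$) $A,\Pi\to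 B\ /\ \Pi\to A\backslash B$; ($/\to$) $\Pi\to A$, $\Gamma_1,B,\Gamma_2\to C\ /\ \Gamma_1,B/A,\Pi,\Gamma_2\to C$; ($\to/$) $\Pi,A\to B\ /\ \Pi\to B/A$; ($\mathbf{1}\to$) $\Gamma_1,\Gamma_2\to C\ /\ \Gamma_1,\mathbf{1},\Gamma_2\to C$; ($\vee\to$) $\Gamma_1,A_1,\Gamma_2\to C$, $\Gamma_1,A_2,\Gamma_2\to C\ /\ \Gamma_1,A_1\vee A_2,\Gamma_2\to C$; ($\to\vee$) $\Gamma\to A_i\ /\ \Gamma\to A_1\vee A_2$; ($\wedge\to$) $\Gamma_1,A_i,\Gamma_2\to C\ /\ \Gamma_1,A_1\wedge A_2,\Gamma_2\to C$; ($\to\wedge$) $\Gamma\to A_1$, $\Gamma\to A_2\ /\ \Gamma\to A_1\wedge A_2$; (${!}\to$) $\Gamma_1,A,\Gamma_2\to C\ /\ \Gamma_1,{!}^sA,\Gamma_2\to C$; ($\to{!}$) ${!}^{s_1}A_1,\dots,{!}^{s_n}A_n\to B\ /\ {!}^{s_1}A_1,\dots,{!}^{s_n}A_n\to{!}^sB$ if $s\preceq s_j$ for all $j$; (weak, $s\in\mathcal{W}$) $\Gamma_1,\Gamma_2\to C\ /\ \Gamma_1,{!}^sA,\Gamma_2\to C$; (ncontr, $s\in\mathcal{C}$) $\Gamma_1,{!}^sA,\Delta,{!}^sA,\Gamma_2\to C\ /\ \Gamma_1,{!}^sA,\Delta,\Gamma_2\to C$ and also $/\ \Gamma_1,\Delta,{!}^sA,\Gamma_2\to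 C$; (ex, $s\in\mathcal{E}$) $\Gamma_1,\Delta,{!}^sA,\Gamma_2\to C\ /\ \Gamma_1,{!}^sA,\Delta,\Gamma_2\to C$ and $\Gamma_1,{!}^sA,\Delta,\Gamma_2\to C\ /\ \Gamma_1,\Delta,{!}^sA,\Gamma_2\to C$. (Here "premises / conclusion".) $\mathrm{SCLL}_\Sigma$ (cut-free): atoms $p_i,\bar p_i$; formulae from atoms and $\mathbf{1},\bot,\top,\mathbf{0}$ using $\otimes$, $\wp$ (par), $\mathbin{\&}$, $\oplus$, ${!}^s$, ${?}^s$. Negation: $p_i^\bot=\bar p_i$, $\bar p_i^\bot=p_i$, $(A\otimes B)^\bot=B^\bot\wp A^\bot$, $(A\wp B)^\bot=B^\bot\otimes A^\bot$, $(A\oplus B)^\bot=A^\bot\mathbin{\&}B^\bot$, $(A\mathbin{\&}B)^\bot=A^\bot\oplus B^\bot$, $({!}^sA)^\bot={?}^sA^\bot$, $({?}^sA)^\bot={!}^sA^\bot$, $\mathbf{1}^\bot=\bot$, $\bot^\bot=\mathbf{1}$, $\mathbf{0}^\bot=\top$, $\top^\bot=\mathbf{0}$. Sequents $\vdash\Gamma$, $\Gamma$ a nonempty cyclically ordered sequence ($\vdash\Gamma_1,\Gamma_2$ identified with $\vdash\Gamma_2,\Gamma_1$, no other permutations). Rules: $\vdash A,A^\bot$; $\vdash\Gamma,A$, $\vdash B,\Delta\ /\ \vdash\Gamma,A\otimes B,\Delta$; $\vdash A,B,\Gamma\ /\ \vdash A\wp B,\Gamma$; $\vdash A_1,\Gamma$,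 $\vdash A_2,\Gamma\ /\ \vdash A_1\mathbin{\&}A_2,\Gamma$; $\vdash A_i,\Gamma\ /\ \vdash A_1\oplus A_2,\Gamma$; $\vdash\mathbf{1}$; $\vdash\Gamma\ /\ \vdash\bot,\Gamma$; $\vdash\top,\Gamma$; $\vdash B,{?}^{s_1}A_1,\dots,{?}^{s_n}A_n\ /\ \vdash{!}^sB,{?}^{s_1}A_1,\dots,{?}^{s_n}A_n$ if $s\preceq s_j$ for all $j$; $\vdash A,\Gamma\ /\ \vdash{?}^sA,\Gamma$; for $s\in\mathcal{W}$: $\vdash\Gamma\ /\ \vdash{?}^sA,\Gamma$; for $s\in\mathcal{C}$: $\vdash{?}^sA,\Gamma,{?}^sA,\Delta\ /\ \vdash{?}^sA,\Gamma,\Delta$; for $s\in\mathcal{E}$: $\vdash\Gamma,{?}^sA,\Delta\ /\ \vdash{?}^sA,\Gamma,\Delta$. No rule for $\mathbf{0}$, no cut. Translation: $\widehat{p_i}=p_i$, $\widehat{\mathbf{1}}=\mathbf{1}$, $\widehat{A\cdot B}=\widehat A\otimes\widehat B$, $\widehat{A\backslash B}=\widehat A^\bot\wp\widehat B$, $\widehat{B/A}=\widehat B\wp\widehat A^\bot$, $\widehat{A\wedge B}=\widehat A\mathbin{\&}\widehat B$, $\widehat{A\vee B}=\widehat A\oplus\widehat B$, $\widehat{{!}^sA}={!}^s\widehat A$; for $\Pi=A_1,\dots,A_k$, $\widehat\Pi^\bot$ is $\widehat{A_k}^\bot,\dots,\widehat{A_1}^\bot$. -}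

module Defs where

open import Data.Nat using (ℕ)
open import Data.Fin using (Fin)
open import Data.List using (List; []; _∷_; _++_; [_]; map; reverse)
open import Data.Product using (_×_)
open import Relation.Binary.PropositionalEquality using (_≡_)
open import Relation.Binary.Structures using (IsPreorder)

-- Subexponential signatures.  The finite label set 𝓘 is represented
-- (up to bijection) as Fin n.

record SubexpSig : Set₁ where
  field
    n       : ℕ
    _≼_     : Fin n → Fin n → Set
    isPre   : IsPreorder _≡_ _≼_
    𝓦 𝓒 𝓔  : Fin n → Set
    𝓦-up    : ∀ {s t} → s ≼ t → 𝓦 s → 𝓦 t
    𝓒-up    : ∀ {s t} → s ≼ t → 𝓒 s → 𝓒 t
    𝓔-up    : ∀ {s t} → s ≼ t → 𝓔 s → 𝓔 t
    𝓦𝓒⊆𝓔   : ∀ {s} → 𝓦 s → 𝓒 s → 𝓔 s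

data Fm (k : ℕ) : Set where
  var  : ℕ → Fm k
  𝟏    : Fm k
  _·_  : Fm k → Fm k → Fm k
  _∖_  : Fm k → Fm k → Fm k
  _╱_  : Fm k → Fm k → Fm k
  _∧_  : Fm k → Fm k → Fm k
  _∨_  : Fm k → Fm k → Fm k
  !    : Fin k → Fm k → Fm k

module SMALC (S : SubexpSig) where
  open SubexpSig S

  F : Set
  F = Fm n

  data BangCtx (s : Fin n) : List F → Set where
    []  : BangCtx s []
    _∷_ : ∀ {t A Γ} → s ≼ t → BangCtx s Γ → BangCtx s (! t A ∷ Γ)

  infix 4 _⇒_
  data _⇒_ : List F → F → Set where
    ax    : ∀ {A} → [ A ] ⇒ A
    →𝟏    : [] ⇒ 𝟏
    ·→    : ∀ {Γ₁ Γ₂ A B C} → Γ₁ ++ A ∷ B ∷ Γ₂ ⇒ C → Γ₁ ++ (A · B) ∷ Γ₂ ⇒ C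
    →·    : ∀ {Γ₁ Γ₂ A B} → Γ₁ ⇒ A → Γ₂ ⇒ B → Γ₁ ++ Γ₂ ⇒ A · B
    ∖→    : ∀ {Π Γ₁ Γ₂ A B C} → Π ⇒ A → Γ₁ ++ B ∷ Γ₂ ⇒ C
          → Γ₁ ++ Π ++ (A ∖ B) ∷ Γ₂ ⇒ C
    →∖    : ∀ {Π A B} → A ∷ Π ⇒ B → Π ⇒ A ∖ B
    ╱→    : ∀ {Π Γ₁ Γ₂ A B C} → Π ⇒ A → Γ₁ ++ B ∷ Γ₂ ⇒ C
          → Γ₁ ++ (B ╱ A) ∷ Π ++ Γ₂ ⇒ C
    →╱    : ∀ {Π A B} → Π ++ [ A ] ⇒ B → Π ⇒ B ╱ A
    𝟏→    : ∀ {Γ₁ Γ₂ C} → Γ₁ ++ Γ₂ ⇒ C → Γ₁ ++ 𝟏 ∷ Γ₂ ⇒ C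
    ∨→    : ∀ {Γ₁ Γ₂ A₁ A₂ C} → Γ₁ ++ A₁ ∷ Γ₂ ⇒ C → Γ₁ ++ A₂ ∷ Γ₂ ⇒ C
          → Γ₁ ++ (A₁ ∨ A₂) ∷ Γ₂ ⇒ C
    →∨₁   : ∀ {Γ A₁ A₂} → Γ ⇒ A₁ → Γ ⇒ A₁ ∨ A₂
    →∨₂   : ∀ {Γ A₁ A₂} → Γ ⇒ A₂ → Γ ⇒ A₁ ∨ A₂
    ∧₁→   : ∀ {Γ₁ Γ₂ A₁ A₂ C} → Γ₁ ++ A₁ ∷ Γ₂ ⇒ C → Γ₁ ++ (A₁ ∧ A₂) ∷ Γ₂ ⇒ C
    ∧₂→   : ∀ {Γ₁ Γ₂ A₁ A₂ C} → Γ₁ ++ A₂ ∷ Γ₂ ⇒ C → Γ₁ ++ (A₁ ∧ A₂) ∷ Γ₂ ⇒ C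
    →∧    : ∀ {Γ A₁ A₂} → Γ ⇒ A₁ → Γ ⇒ A₂ → Γ ⇒ A₁ ∧ A₂
    !→    : ∀ {Γ₁ Γ₂ s A C} → Γ₁ ++ A ∷ Γ₂ ⇒ C → Γ₁ ++ ! s A ∷ Γ₂ ⇒ C
    →!    : ∀ {Γ s B} → BangCtx s Γ → Γ ⇒ B → Γ ⇒ ! s B
    weak  : ∀ {Γ₁ Γ₂ s A C} → 𝓦 s → Γ₁ ++ Γ₂ ⇒ C → Γ₁ ++ ! s A ∷ Γ₂ ⇒ C
    ncontr₁ : ∀ {Γ₁ Δ Γ₂ s A C} → 𝓒 s
            → Γ₁ ++ ! s A ∷ Δ ++ ! s A ∷ Γ₂ ⇒ C → Γ₁ ++ ! s A ∷ Δ ++ Γ₂ ⇒ C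
    ncontr₂ : ∀ {Γ₁ Δ Γ₂ s A C} → 𝓒 s
            → Γ₁ ++ ! s A ∷ Δ ++ ! s A ∷ Γ₂ ⇒ C → Γ₁ ++ Δ ++ ! s A ∷ Γ₂ ⇒ C
    ex₁   : ∀ {Γ₁ Δ Γ₂ s A C} → 𝓔 s
          → Γ₁ ++ Δ ++ ! s A ∷ Γ₂ ⇒ C → Γ₁ ++ ! s A ∷ Δ ++ Γ₂ ⇒ C
    ex₂   : ∀ {Γ₁ Δ Γ₂ s A C} → 𝓔 s
          → Γ₁ ++ ! s A ∷ Δ ++ Γ₂ ⇒ C → Γ₁ ++ Δ ++ ! s A ∷ Γ₂ ⇒ C

data LFm (k : ℕ) : Set where
  pos  : ℕ → LFm k
  neg  : ℕ → LFm k
  𝟙 ⊥ₗ ⊤ₗ 𝟘 : LFm k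
  _⊗_ _⅋_ _&_ _⊕_ : LFm k → LFm k → LFm k
  !ₗ ?ₗ : Fin k → LFm k → LFm k

_ᗮ : ∀ {k} → LFm k → LFm k
pos i ᗮ = neg i
neg i ᗮ = pos i
𝟙 ᗮ = ⊥ₗ
⊥ₗ ᗮ = 𝟙
⊤ₗ ᗮ = 𝟘
𝟘 ᗮ = ⊤ₗ
(A ⊗ B) ᗮ = (B ᗮ) ⅋ (A ᗮ)
(A ⅋ B) ᗮ = (B ᗮ) ⊗ (A ᗮ)
(A & B) ᗮ = (A ᗮ) ⊕ (B ᗮ)
(A ⊕ B) ᗮ = (A ᗮ) & (B ᗮ)
(!ₗ s A) ᗮ = ?ₗ s (A ᗮ)
(?ₗ s A) ᗮ = !ₗ s (A ᗮ)

module SCLL (S : SubexpSig) where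
  open SubexpSig S

  L : Set
  L = LFm n

  data WhyCtx (s : Fin n) : List L → Set where
    []  : WhyCtx s []
    _∷_ : ∀ {t A Γ} → s ≼ t → WhyCtx s Γ → WhyCtx s (?ₗ t A ∷ Γ)

  -- Sequents are lists read cyclically: the rule `rot` realises the
  -- identification of ⊢ Γ₁,Γ₂ with ⊢ Γ₂,Γ₁.
  data ⊢_ : List L → Set where
    ax   : ∀ {A} → ⊢ (A ∷ [ A ᗮ ])
    ⊗r   : ∀ {Γ Δ A B} → ⊢ (Γ ++ [ A ]) → ⊢ (B ∷ Δ) → ⊢ (Γ ++ (A ⊗ B) ∷ Δ)
    ⅋r   : ∀ {Γ A B} → ⊢ (A ∷ B ∷ Γ) → ⊢ ((A ⅋ B) ∷ Γ)
    &r   : ∀ {Γ A₁ A₂} → ⊢ (A₁ ∷ Γ) → ⊢ (A₂ ∷ Γ) → ⊢ ((A₁ & A₂) ∷ Γ)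
    ⊕r₁  : ∀ {Γ A₁ A₂} → ⊢ (A₁ ∷ Γ) → ⊢ ((A₁ ⊕ A₂) ∷ Γ)
    ⊕r₂  : ∀ {Γ A₁ A₂} → ⊢ (A₂ ∷ Γ) → ⊢ ((A₁ ⊕ A₂) ∷ Γ)
    𝟙r   : ⊢ [ 𝟙 ]
    ⊥r   : ∀ {Γ} → ⊢ Γ → ⊢ (⊥ₗ ∷ Γ)
    ⊤r   : ∀ {Γ} → ⊢ (⊤ₗ ∷ Γ)
    !r   : ∀ {Γ s B} → WhyCtx s Γ → ⊢ (B ∷ Γ) → ⊢ (!ₗ s B ∷ Γ)
    ?r   : ∀ {Γ s A} → ⊢ (A ∷ Γ) → ⊢ (?ₗ s A ∷ Γ)
    weak : ∀ {Γ s A} → 𝓦 s → ⊢ Γ → ⊢ (?ₗ s A ∷ Γ)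
    contr : ∀ {Γ Δ s A} → 𝓒 s → ⊢ (?ₗ s A ∷ Γ ++ ?ₗ s A ∷ Δ) → ⊢ (?ₗ s A ∷ Γ ++ Δ)
    ex   : ∀ {Γ Δ s A} → 𝓔 s → ⊢ (Γ ++ ?ₗ s A ∷ Δ) → ⊢ (?ₗ s A ∷ Γ ++ Δ)
    rot  : ∀ {Γ₁ Γ₂} → ⊢ (Γ₁ ++ Γ₂) → ⊢ (Γ₂ ++ Γ₁)

tr : ∀ {k} → Fm k → LFm k
tr (var i) = pos i
tr 𝟏 = 𝟙
tr (A · B) = tr A ⊗ tr B
tr (A ∖ B) = (tr A ᗮ) ⅋ tr B
tr (B ╱ A) = tr B ⅋ (tr A ᗮ)
tr (A ∧ B) = tr A & tr B
tr (A ∨ B) = tr A ⊕ tr B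
tr (! s A) = !ₗ s (tr A)

trCtxᗮ : ∀ {k} → List (Fm k) → List (LFm k)
trCtxᗮ Π = map (λ A → tr A ᗮ) (reverse Π)

-- Read ⊢ Γ cyclically: the translation of Π → C is the cycle tr C, then the
-- negated antecedent in reverse order. Forwards, every SMALC rule becomes the
-- SCLL rule on the translated principal formula, after rotating that formula
-- to the front. Backwards, induct on the cut-free SCLL derivation with the
-- invariant that the sequent is a rotation of a translated sequent. Its first
-- formula is then either the translated succedent or a negated antecedent
-- formula, and inverting the translation there identifies the SMALC rule. The
-- only choice is in the tensor rule, where the translated succedent has to go
-- to the premise whose active formula is negative: a sequent made of negated
-- translations only is never derivable.
module Submission where

open import Defs
open import Data.Nat using (ℕ)
open import Data.Fin using (Fin)
open import Data.Empty using (⊥; ⊥-elim)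
open import Data.Product using (_×_; _,_; ∃; ∃₂)
open import Data.Sum using (_⊎_; inj₁; inj₂)
open import Data.List using (List; []; _∷_; _++_; [_]; _∷ʳ_; map; reverse)
open import Data.List.Properties
  using (++-assoc; ++-identityʳ; map-++; reverse-++; ∷-injective; ∷ʳ-++)
open import Data.List.Reverse using (reverseView; []; _∶_∶ʳ_)
open import Data.List.Relation.Unary.All using (All; []; _∷_; universal)
import Data.List.Relation.Unary.All.Properties as All
open import Function using (flip)
open import Relation.Binary.PropositionalEquality
  using (_≡_; _≢_; refl; sym; trans; cong; cong₂; subst; module ≡-Reasoning)

private variable
  k : ℕ
  A B : LFm k
  X Y C : Fm k
  Γ Δ : List (LFm k)
  Π Π₁ Π₂ : List (Fm k)

ᗮ-involutive : (A : LFm k) → A ᗮ ᗮ ≡ A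
ᗮ-involutive (pos i)  = refl
ᗮ-involutive (neg i)  = refl
ᗮ-involutive 𝟙        = refl
ᗮ-involutive ⊥ₗ       = refl
ᗮ-involutive ⊤ₗ       = refl
ᗮ-involutive 𝟘        = refl
ᗮ-involutive (A ⊗ B)  = cong₂ _⊗_ (ᗮ-involutive A) (ᗮ-involutive B)
ᗮ-involutive (A ⅋ B)  = cong₂ _⅋_ (ᗮ-involutive A) (ᗮ-involutive B)
ᗮ-involutive (A & B)  = cong₂ _&_ (ᗮ-involutive A) (ᗮ-involutive B)
ᗮ-involutive (A ⊕ B)  = cong₂ _⊕_ (ᗮ-involutive A) (ᗮ-involutive B)
ᗮ-involutive (!ₗ s A) = cong (!ₗ s) (ᗮ-involutive A)
ᗮ-involutive (?ₗ s A) = cong (?ₗ s) (ᗮ-involutive A)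

ᗮ-injective : A ᗮ ≡ B ᗮ → A ≡ B
ᗮ-injective {A = A} {B} eq =
  trans (sym (ᗮ-involutive A)) (trans (cong _ᗮ eq) (ᗮ-involutive B))

trᗮ : Fm k → LFm k
trᗮ X = tr X ᗮ

-- Tr A X says that A is tr X and Trᗮ A X that A is trᗮ X, both up to
-- double negation; matching on them inverts the translation.
data Tr {k : ℕ} : LFm k → Fm k → Set
data Trᗮ {k : ℕ} : LFm k → Fm k → Set

data Tr where
  var : ∀ i → Tr (pos i) (var i)
  𝟏   : Tr 𝟙 𝟏
  _·_ : Tr A X → Tr B Y → Tr (A ⊗ B) (X · Y)
  _∖_ : Trᗮ A X → Tr B Y → Tr (A ⅋ B) (X ∖ Y)
  _╱_ : Tr A X → Trᗮ B Y → Tr (A ⅋ B) (X ╱ Y)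
  _∧_ : Tr A X → Tr B Y → Tr (A & B) (X ∧ Y)
  _∨_ : Tr A X → Tr B Y → Tr (A ⊕ B) (X ∨ Y)
  !   : ∀ s → Tr A X → Tr (!ₗ s A) (! s X)

data Trᗮ where
  var : ∀ i → Trᗮ (neg i) (var i)
  𝟏   : Trᗮ ⊥ₗ 𝟏
  _·_ : Trᗮ A X → Trᗮ B Y → Trᗮ (B ⅋ A) (X · Y)
  _∖_ : Tr A X → Trᗮ B Y → Trᗮ (B ⊗ A) (X ∖ Y)
  _╱_ : Trᗮ A X → Tr B Y → Trᗮ (B ⊗ A) (X ╱ Y)
  _∧_ : Trᗮ A X → Trᗮ B Y → Trᗮ (A ⊕ B) (X ∧ Y)
  _∨_ : Trᗮ A X → Trᗮ B Y → Trᗮ (A & B) (X ∨ Y)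
  ?ₗ  : ∀ s → Trᗮ A X → Trᗮ (?ₗ s A) (! s X)

tr-Tr : (X : Fm k) → Tr (tr X) X
trᗮ-Trᗮ : (X : Fm k) → Trᗮ (trᗮ X) X
trᗮᗮ-Tr : (X : Fm k) → Tr (trᗮ X ᗮ) X

tr-Tr (var i) = var i
tr-Tr 𝟏       = 𝟏
tr-Tr (X · Y) = tr-Tr X · tr-Tr Y
tr-Tr (X ∖ Y) = trᗮ-Trᗮ X ∖ tr-Tr Y
tr-Tr (X ╱ Y) = tr-Tr X ╱ trᗮ-Trᗮ Y
tr-Tr (X ∧ Y) = tr-Tr X ∧ tr-Tr Y
tr-Tr (X ∨ Y) = tr-Tr X ∨ tr-Tr Y
tr-Tr (! s X) = ! s (tr-Tr X)

trᗮ-Trᗮ (var i) = var i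
trᗮ-Trᗮ 𝟏       = 𝟏
trᗮ-Trᗮ (X · Y) = trᗮ-Trᗮ X · trᗮ-Trᗮ Y
trᗮ-Trᗮ (X ∖ Y) = trᗮᗮ-Tr X ∖ trᗮ-Trᗮ Y
trᗮ-Trᗮ (X ╱ Y) = trᗮ-Trᗮ X ╱ trᗮᗮ-Tr Y
trᗮ-Trᗮ (X ∧ Y) = trᗮ-Trᗮ X ∧ trᗮ-Trᗮ Y
trᗮ-Trᗮ (X ∨ Y) = trᗮ-Trᗮ X ∨ trᗮ-Trᗮ Y
trᗮ-Trᗮ (! s X) = ?ₗ s (trᗮ-Trᗮ X)

trᗮᗮ-Tr X = subst (flip Tr X) (sym (ᗮ-involutive (tr X))) (tr-Tr X)

Tr⇒≡ : Tr A X → A ≡ tr X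
Trᗮ⇒≡ : Trᗮ A X → A ≡ trᗮ X

Tr⇒≡ (var i) = refl
Tr⇒≡ 𝟏       = refl
Tr⇒≡ (a · b) = cong₂ _⊗_ (Tr⇒≡ a) (Tr⇒≡ b)
Tr⇒≡ (a ∖ b) = cong₂ _⅋_ (Trᗮ⇒≡ a) (Tr⇒≡ b)
Tr⇒≡ (a ╱ b) = cong₂ _⅋_ (Tr⇒≡ a) (Trᗮ⇒≡ b)
Tr⇒≡ (a ∧ b) = cong₂ _&_ (Tr⇒≡ a) (Tr⇒≡ b)
Tr⇒≡ (a ∨ b) = cong₂ _⊕_ (Tr⇒≡ a) (Tr⇒≡ b)
Tr⇒≡ (! s a) = cong (!ₗ s) (Tr⇒≡ a)

Trᗮ⇒≡ (var i) = refl
Trᗮ⇒≡ 𝟏       = refl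
Trᗮ⇒≡ (a · b) = cong₂ _⅋_ (Trᗮ⇒≡ b) (Trᗮ⇒≡ a)
Trᗮ⇒≡ {X = X ∖ _} (a ∖ b) =
  cong₂ _⊗_ (Trᗮ⇒≡ b) (trans (Tr⇒≡ a) (sym (ᗮ-involutive (tr X))))
Trᗮ⇒≡ {X = _ ╱ Y} (a ╱ b) =
  cong₂ _⊗_ (trans (Tr⇒≡ b) (sym (ᗮ-involutive (tr Y)))) (Trᗮ⇒≡ a)
Trᗮ⇒≡ (a ∧ b) = cong₂ _⊕_ (Trᗮ⇒≡ a) (Trᗮ⇒≡ b)
Trᗮ⇒≡ (a ∨ b) = cong₂ _&_ (Trᗮ⇒≡ a) (Trᗮ⇒≡ b)
Trᗮ⇒≡ (?ₗ s a) = cong (?ₗ s) (Trᗮ⇒≡ a)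

Tr-functional : Tr A X → Tr A Y → X ≡ Y
Trᗮ-functional : Trᗮ A X → Trᗮ A Y → X ≡ Y
Tr-Trᗮ-disjoint : Tr A X → Trᗮ A Y → ⊥

Tr-functional (var i) (var i) = refl
Tr-functional 𝟏 𝟏 = refl
Tr-functional (a · b) (a′ · b′) = cong₂ _·_ (Tr-functional a a′) (Tr-functional b b′)
Tr-functional (a ∖ b) (a′ ∖ b′) = cong₂ _∖_ (Trᗮ-functional a a′) (Tr-functional b b′)
Tr-functional (a ∖ b) (a′ ╱ b′) = ⊥-elim (Tr-Trᗮ-disjoint a′ a)
Tr-functional (a ╱ b) (a′ ∖ b′) = ⊥-elim (Tr-Trᗮ-disjoint a a′)
Tr-functional (a ╱ b) (a′ ╱ b′) = cong₂ _╱_ (Tr-functional a a′) (Trᗮ-functional b b′)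
Tr-functional (a ∧ b) (a′ ∧ b′) = cong₂ _∧_ (Tr-functional a a′) (Tr-functional b b′)
Tr-functional (a ∨ b) (a′ ∨ b′) = cong₂ _∨_ (Tr-functional a a′) (Tr-functional b b′)
Tr-functional (! s a) (! s a′) = cong (! s) (Tr-functional a a′)

Trᗮ-functional (var i) (var i) = refl
Trᗮ-functional 𝟏 𝟏 = refl
Trᗮ-functional (a · b) (a′ · b′) = cong₂ _·_ (Trᗮ-functional a a′) (Trᗮ-functional b b′)
Trᗮ-functional (a ∖ b) (a′ ∖ b′) = cong₂ _∖_ (Tr-functional a a′) (Trᗮ-functional b b′)
Trᗮ-functional (a ∖ b) (a′ ╱ b′) = ⊥-elim (Tr-Trᗮ-disjoint a a′)
Trᗮ-functional (a ╱ b) (a′ ∖ b′) = ⊥-elim (Tr-Trᗮ-disjoint a′ a)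
Trᗮ-functional (a ╱ b) (a′ ╱ b′) = cong₂ _╱_ (Trᗮ-functional a a′) (Tr-functional b b′)
Trᗮ-functional (a ∧ b) (a′ ∧ b′) = cong₂ _∧_ (Trᗮ-functional a a′) (Trᗮ-functional b b′)
Trᗮ-functional (a ∨ b) (a′ ∨ b′) = cong₂ _∨_ (Trᗮ-functional a a′) (Trᗮ-functional b b′)
Trᗮ-functional (?ₗ s a) (?ₗ s a′) = cong (! s) (Trᗮ-functional a a′)

Tr-Trᗮ-disjoint (var i) ()
Tr-Trᗮ-disjoint 𝟏 ()
Tr-Trᗮ-disjoint (a · b) (a′ ∖ b′) = Tr-Trᗮ-disjoint a b′
Tr-Trᗮ-disjoint (a · b) (a′ ╱ b′) = Tr-Trᗮ-disjoint b a′
Tr-Trᗮ-disjoint (a ∖ b) (a′ · b′) = Tr-Trᗮ-disjoint b a′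
Tr-Trᗮ-disjoint (a ╱ b) (a′ · b′) = Tr-Trᗮ-disjoint a b′
Tr-Trᗮ-disjoint (a ∧ b) (a′ ∨ b′) = Tr-Trᗮ-disjoint a a′
Tr-Trᗮ-disjoint (a ∨ b) (a′ ∧ b′) = Tr-Trᗮ-disjoint a a′
Tr-Trᗮ-disjoint (! s a) ()

tr-injective : tr X ≡ tr Y → X ≡ Y
tr-injective {X = X} {Y} eq = Tr-functional (tr-Tr X) (subst (flip Tr Y) (sym eq) (tr-Tr Y))

tr≢trᗮ : tr X ≢ trᗮ Y
tr≢trᗮ {X = X} {Y} eq = Tr-Trᗮ-disjoint (tr-Tr X) (subst (flip Trᗮ Y) (sym eq) (trᗮ-Trᗮ Y))

module _ {a} {E : Set a} where

  ++-split : (w x y z : List E) → w ++ x ≡ y ++ z →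
             (∃ λ m → y ≡ w ++ m × x ≡ m ++ z) ⊎ (∃ λ m → w ≡ y ++ m × z ≡ m ++ x)
  ++-split []      x y       z eq   = inj₁ (y , refl , eq)
  ++-split (v ∷ w) x []      z eq   = inj₂ (v ∷ w , refl , sym eq)
  ++-split (v ∷ w) x (u ∷ y) z eq with ∷-injective eq
  ... | refl , eq′ with ++-split w x y z eq′
  ...   | inj₁ (m , refl , refl) = inj₁ (m , refl , refl)
  ...   | inj₂ (m , refl , refl) = inj₂ (m , refl , refl)

  ++-split-∷ : (Δ Γ L₁ : List E) (c : E) (L₂ : List E) → Δ ++ Γ ≡ L₁ ++ c ∷ L₂ →
               (∃ λ m → Δ ≡ L₁ ++ c ∷ m × L₂ ≡ m ++ Γ) ⊎ (∃ λ m → L₁ ≡ Δ ++ m × Γ ≡ m ++ c ∷ L₂)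
  ++-split-∷ Δ Γ L₁ c L₂ eq with ++-split Δ Γ L₁ (c ∷ L₂) eq
  ... | inj₁ (m , eq₁ , eq₂)         = inj₂ (m , eq₁ , eq₂)
  ... | inj₂ ([] , eq₁ , refl)       =
    inj₂ ([] , sym (trans (++-identityʳ Δ) (trans eq₁ (++-identityʳ L₁))) , refl)
  ... | inj₂ (_ ∷ m , refl , refl)   = inj₁ (m , refl , refl)

  infix 4 _↻_
  data _↻_ (Γ Δ : List E) : Set a where
    rotation : ∀ x y → Γ ≡ x ++ y → Δ ≡ y ++ x → Γ ↻ Δ

  ↻-swap : ∀ x y → x ++ y ↻ y ++ x
  ↻-swap x y = rotation x y refl refl

  ↻-refl : ∀ {Γ} → Γ ↻ Γ
  ↻-refl {Γ} = rotation [] Γ refl (sym (++-identityʳ Γ))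

  ↻-reflexive : ∀ {Γ Δ} → Γ ≡ Δ → Γ ↻ Δ
  ↻-reflexive refl = ↻-refl

  ↻-sym : ∀ {Γ Δ} → Γ ↻ Δ → Δ ↻ Γ
  ↻-sym (rotation x y refl refl) = rotation y x refl refl

  ↻-trans : ∀ {Γ Δ Θ} → Γ ↻ Δ → Δ ↻ Θ → Γ ↻ Θ
  ↻-trans (rotation x y refl refl) (rotation u v eq refl) with ++-split y x u v eq
  ... | inj₁ (m , refl , refl) = rotation m (v ++ y) (++-assoc m v y) (sym (++-assoc v y m))
  ... | inj₂ (m , refl , refl) = rotation (x ++ u) m (sym (++-assoc x u m)) (++-assoc m x u)

  ↻-pair⁻ : ∀ {x y Θ} → x ∷ [ y ] ↻ Θ → Θ ≡ x ∷ [ y ] ⊎ Θ ≡ y ∷ [ x ]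
  ↻-pair⁻ (rotation []                _       refl refl) = inj₁ (++-identityʳ _)
  ↻-pair⁻ (rotation (_ ∷ [])          _       refl refl) = inj₂ refl
  ↻-pair⁻ (rotation (_ ∷ _ ∷ [])      []      refl refl) = inj₁ refl
  ↻-pair⁻ (rotation (_ ∷ _ ∷ [])      (_ ∷ _) ()   _)
  ↻-pair⁻ (rotation (_ ∷ _ ∷ _ ∷ _)   _       ()   _)

  ∷-↻⁻ : ∀ {P Γ Θ} → P ∷ Γ ↻ Θ → ∃₂ λ Θ₁ Θ₂ → Θ ≡ Θ₁ ++ P ∷ Θ₂ × Γ ≡ Θ₂ ++ Θ₁
  ∷-↻⁻ (rotation []      y refl refl) = [] , _ , ++-identityʳ _ , sym (++-identityʳ _)
  ∷-↻⁻ (rotation (_ ∷ x) y refl refl) = y , x , refl , refl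

trCtxᗮ-++ : (Π₁ Π₂ : List (Fm k)) → trCtxᗮ (Π₁ ++ Π₂) ≡ trCtxᗮ Π₂ ++ trCtxᗮ Π₁
trCtxᗮ-++ Π₁ Π₂ = trans (cong (map trᗮ) (reverse-++ Π₁ Π₂)) (map-++ trᗮ (reverse Π₂) (reverse Π₁))

trCtxᗮ-++-++ : (Π₁ Π₂ Π₃ : List (Fm k)) →
               trCtxᗮ (Π₁ ++ Π₂ ++ Π₃) ≡ trCtxᗮ Π₃ ++ trCtxᗮ Π₂ ++ trCtxᗮ Π₁
trCtxᗮ-++-++ Π₁ Π₂ Π₃ = begin
  trCtxᗮ (Π₁ ++ Π₂ ++ Π₃)                  ≡⟨ trCtxᗮ-++ Π₁ (Π₂ ++ Π₃) ⟩
  trCtxᗮ (Π₂ ++ Π₃) ++ trCtxᗮ Π₁            ≡⟨ cong (_++ trCtxᗮ Π₁) (trCtxᗮ-++ Π₂ Π₃) ⟩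
  (trCtxᗮ Π₃ ++ trCtxᗮ Π₂) ++ trCtxᗮ Π₁    ≡⟨ ++-assoc (trCtxᗮ Π₃) _ _ ⟩
  trCtxᗮ Π₃ ++ trCtxᗮ Π₂ ++ trCtxᗮ Π₁      ∎
  where open ≡-Reasoning

trCtxᗮ-∷ : (Π₁ : List (Fm k)) (Z : Fm k) (Π₂ : List (Fm k)) →
           trCtxᗮ (Π₁ ++ Z ∷ Π₂) ≡ trCtxᗮ Π₂ ++ trᗮ Z ∷ trCtxᗮ Π₁
trCtxᗮ-∷ Π₁ Z = trCtxᗮ-++-++ Π₁ [ Z ]

trCtxᗮ-∷-∷ : (Π₁ : List (Fm k)) (Y : Fm k) (Π₂ : List (Fm k)) (Z : Fm k) (Π₃ : List (Fm k)) →
             trCtxᗮ (Π₁ ++ Y ∷ Π₂ ++ Z ∷ Π₃) ≡ trCtxᗮ Π₃ ++ trᗮ Z ∷ trCtxᗮ Π₂ ++ trᗮ Y ∷ trCtxᗮ Π₁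
trCtxᗮ-∷-∷ Π₁ Y Π₂ Z Π₃ = trans (trCtxᗮ-∷ Π₁ Y (Π₂ ++ Z ∷ Π₃))
  (trans (cong (_++ trᗮ Y ∷ trCtxᗮ Π₁) (trCtxᗮ-∷ Π₂ Z Π₃)) (++-assoc (trCtxᗮ Π₃) _ _))

trCtxᗮ-∷-++ : (Π₁ : List (Fm k)) (Z : Fm k) (Π₂ Π₃ : List (Fm k)) →
              trCtxᗮ (Π₁ ++ Z ∷ Π₂ ++ Π₃) ≡ trCtxᗮ Π₃ ++ trCtxᗮ Π₂ ++ trᗮ Z ∷ trCtxᗮ Π₁
trCtxᗮ-∷-++ Π₁ Z Π₂ Π₃ = trans (trCtxᗮ-∷ Π₁ Z (Π₂ ++ Π₃))
  (trans (cong (_++ trᗮ Z ∷ trCtxᗮ Π₁) (trCtxᗮ-++ Π₂ Π₃)) (++-assoc (trCtxᗮ Π₃) _ _))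

trCtxᗮ-++-∷ : (Π₁ Π₂ : List (Fm k)) (Z : Fm k) (Π₃ : List (Fm k)) →
              trCtxᗮ (Π₁ ++ Π₂ ++ Z ∷ Π₃) ≡ trCtxᗮ Π₃ ++ trᗮ Z ∷ trCtxᗮ Π₂ ++ trCtxᗮ Π₁
trCtxᗮ-++-∷ Π₁ Π₂ Z Π₃ = trans (trCtxᗮ-++ Π₁ (Π₂ ++ Z ∷ Π₃))
  (trans (cong (_++ trCtxᗮ Π₁) (trCtxᗮ-∷ Π₂ Z Π₃)) (++-assoc (trCtxᗮ Π₃) _ _))

trCtxᗮ-∷⁻ : ∀ {P} {ys : List (LFm k)} (Π : List (Fm k)) → trCtxᗮ Π ≡ P ∷ ys →
            ∃₂ λ Π′ Z → Π ≡ Π′ ∷ʳ Z × trᗮ Z ≡ P × trCtxᗮ Π′ ≡ ys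
trCtxᗮ-∷⁻ Π eq with reverseView Π
... | [] with () ← eq
... | Π′ ∶ _ ∶ʳ Z rewrite trCtxᗮ-++ Π′ [ Z ] with refl ← eq = Π′ , Z , refl , refl , refl

trCtxᗮ-++⁻ : ∀ (Π : List (Fm k)) xs ys → trCtxᗮ Π ≡ xs ++ ys →
             ∃₂ λ Π₁ Π₂ → Π ≡ Π₁ ++ Π₂ × trCtxᗮ Π₂ ≡ xs × trCtxᗮ Π₁ ≡ ys
trCtxᗮ-++⁻ Π [] ys eq = Π , [] , sym (++-identityʳ Π) , refl , eq
trCtxᗮ-++⁻ Π (x ∷ xs) ys eq with trCtxᗮ-∷⁻ Π eq
... | Π′ , Z , refl , refl , eq′ with trCtxᗮ-++⁻ Π′ xs ys eq′
...   | Π₁ , Π₂ , refl , refl , refl =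
  Π₁ , Π₂ ∷ʳ Z , ++-assoc Π₁ Π₂ [ Z ] , trCtxᗮ-++ Π₂ [ Z ] , refl

trCtxᗮ-[]⁻ : (Π : List (Fm k)) → trCtxᗮ Π ≡ [] → Π ≡ []
trCtxᗮ-[]⁻ Π eq with reverseView Π
... | [] = refl
... | Π′ ∶ _ ∶ʳ Z rewrite trCtxᗮ-++ Π′ [ Z ] with () ← eq

trCtxᗮ-[_]⁻ : ∀ {P} (Π : List (Fm k)) → trCtxᗮ Π ≡ [ P ] → ∃ λ Z → Π ≡ [ Z ] × trᗮ Z ≡ P
trCtxᗮ-[_]⁻ Π eq with trCtxᗮ-∷⁻ Π eq
... | Π′ , Z , refl , eqZ , eq′ rewrite trCtxᗮ-[]⁻ Π′ eq′ = Z , refl , eqZ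

↻-antecedent : (Π₁ M Π₂ : List (Fm k)) (c : LFm k) →
               trCtxᗮ M ++ trCtxᗮ Π₁ ++ c ∷ trCtxᗮ Π₂ ↻ c ∷ trCtxᗮ (Π₁ ++ M ++ Π₂)
↻-antecedent Π₁ M Π₂ c =
  rotation (trCtxᗮ M ++ trCtxᗮ Π₁) (c ∷ trCtxᗮ Π₂)
    (sym (++-assoc (trCtxᗮ M) (trCtxᗮ Π₁) (c ∷ trCtxᗮ Π₂)))
    (cong (c ∷_) (trCtxᗮ-++-++ Π₁ M Π₂))

data Focus (P : LFm k) (Γ : List (LFm k)) (Π : List (Fm k)) (C : Fm k) : Set where
  succedent  : Tr P C → Γ ≡ trCtxᗮ Π → Focus P Γ Π C
  antecedent : ∀ Π₁ Z Π₂ → Π ≡ Π₁ ++ Z ∷ Π₂ → Trᗮ P Z →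
               Γ ≡ trCtxᗮ Π₁ ++ tr C ∷ trCtxᗮ Π₂ → Focus P Γ Π C

focus : ∀ {P} Π → P ∷ Γ ↻ tr C ∷ trCtxᗮ Π → Focus P Γ Π C
focus Π ρ with ∷-↻⁻ ρ
... | [] , _ , refl , refl = succedent (tr-Tr _) (++-identityʳ _)
... | _ ∷ Θ₁ , Θ₂ , eq , refl with refl , eq′ ← ∷-injective eq
                               with trCtxᗮ-++⁻ Π Θ₁ _ eq′
... | Π₁′ , Π₂ , refl , refl , eq″ with trCtxᗮ-∷⁻ Π₁′ eq″
... | Π₁ , Z , refl , refl , refl = antecedent Π₁ Z Π₂ (∷ʳ-++ Π₁ Z Π₂) (trᗮ-Trᗮ Z) refl

data Split (Γ Δ : List (LFm k)) (Π₁ Π₂ : List (Fm k)) (c : LFm k) : Set where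
  succedent-left  : ∀ Π₂a Π₂b → Π₂ ≡ Π₂a ++ Π₂b →
                    Γ ≡ trCtxᗮ Π₁ ++ c ∷ trCtxᗮ Π₂b → Δ ≡ trCtxᗮ Π₂a → Split Γ Δ Π₁ Π₂ c
  succedent-right : ∀ Π₁a Π₁b → Π₁ ≡ Π₁a ++ Π₁b →
                    Γ ≡ trCtxᗮ Π₁b → Δ ≡ trCtxᗮ Π₁a ++ c ∷ trCtxᗮ Π₂ → Split Γ Δ Π₁ Π₂ c

split : ∀ {c : LFm k} (Γ Δ : List (LFm k)) (Π₁ Π₂ : List (Fm k)) →
        Γ ++ Δ ≡ trCtxᗮ Π₁ ++ c ∷ trCtxᗮ Π₂ → Split Γ Δ Π₁ Π₂ c
split Γ Δ Π₁ Π₂ eq with ++-split-∷ Γ Δ (trCtxᗮ Π₁) _ (trCtxᗮ Π₂) eq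
... | inj₁ (m , refl , eq′) with trCtxᗮ-++⁻ Π₂ m Δ eq′
...   | Π₂a , Π₂b , refl , refl , refl = succedent-left Π₂a Π₂b refl refl refl
split Γ Δ Π₁ Π₂ eq | inj₂ (m , eq′ , refl) with trCtxᗮ-++⁻ Π₁ Γ m eq′
...   | Π₁a , Π₁b , refl , refl , refl = succedent-right Π₁a Π₁b refl refl refl

Negative : LFm k → Set
Negative A = ∃ (Trᗮ A)

trCtxᗮ-negative : (Π : List (Fm k)) → All Negative (trCtxᗮ Π)
trCtxᗮ-negative Π = All.map⁺ (universal (λ X → X , trᗮ-Trᗮ X) (reverse Π))

module _ (S : SubexpSig) where
  open SubexpSig S using (n; 𝓦; 𝓒; 𝓔)
  module Lambek = SMALC S
  module Linear = SCLL S
  open Lambek using (_⇒_; BangCtx)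
  open Linear using (⊢_; WhyCtx)

  ⊢-↻ : Γ ↻ Δ → ⊢ Γ → ⊢ Δ
  ⊢-↻ (rotation x y refl refl) = Linear.rot {x} {y}

  ⊬-negative : ⊢ Γ → All Negative Γ → ⊥
  ⊬-negative Linear.ax ((X , x) ∷ (Y , y) ∷ []) =
    tr≢trᗮ (trans (sym (ᗮ-involutive (tr X))) (trans (cong _ᗮ (sym (Trᗮ⇒≡ x))) (Trᗮ⇒≡ y)))
  ⊬-negative (Linear.⊗r {Γ = Γ} d₁ d₂) negs with All.++⁻ Γ negs
  ... | negΓ , (_ , _ ∖ y) ∷ negΔ = ⊬-negative d₁ (All.++⁺ negΓ ((_ , y) ∷ []))
  ... | negΓ , (_ , x ╱ _) ∷ negΔ = ⊬-negative d₂ ((_ , x) ∷ negΔ)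
  ⊬-negative (Linear.⅋r d) ((_ , x · y) ∷ negs) = ⊬-negative d ((_ , y) ∷ (_ , x) ∷ negs)
  ⊬-negative (Linear.&r d₁ d₂) ((_ , x ∨ _) ∷ negs) = ⊬-negative d₁ ((_ , x) ∷ negs)
  ⊬-negative (Linear.⊕r₁ d) ((_ , x ∧ _) ∷ negs) = ⊬-negative d ((_ , x) ∷ negs)
  ⊬-negative (Linear.⊕r₂ d) ((_ , _ ∧ y) ∷ negs) = ⊬-negative d ((_ , y) ∷ negs)
  ⊬-negative Linear.𝟙r ((_ , ()) ∷ [])
  ⊬-negative (Linear.⊥r d) (_ ∷ negs) = ⊬-negative d negs
  ⊬-negative Linear.⊤r ((_ , ()) ∷ _)
  ⊬-negative (Linear.!r w d) ((_ , ()) ∷ _)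
  ⊬-negative (Linear.?r d) ((_ , ?ₗ s x) ∷ negs) = ⊬-negative d ((_ , x) ∷ negs)
  ⊬-negative (Linear.weak w d) (_ ∷ negs) = ⊬-negative d negs
  ⊬-negative (Linear.contr {Γ = Γ} c d) (p ∷ negs) with All.++⁻ Γ negs
  ... | negΓ , negΔ = ⊬-negative d (p ∷ All.++⁺ negΓ (p ∷ negΔ))
  ⊬-negative (Linear.ex {Γ = Γ} e d) (p ∷ negs) with All.++⁻ Γ negs
  ... | negΓ , negΔ = ⊬-negative d (All.++⁺ negΓ (p ∷ negΔ))
  ⊬-negative (Linear.rot {Γ₂ = Γ₂} d) negs with All.++⁻ Γ₂ negs
  ... | neg₂ , neg₁ = ⊬-negative d (All.++⁺ neg₁ neg₂)

  WhyCtx-++⁺ : ∀ {s} → WhyCtx s Γ → WhyCtx s Δ → WhyCtx s (Γ ++ Δ)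
  WhyCtx-++⁺ Linear.[]      w = w
  WhyCtx-++⁺ (p Linear.∷ v) w = p Linear.∷ WhyCtx-++⁺ v w

  WhyCtx-++⁻ : ∀ {s} Γ → WhyCtx s (Γ ++ Δ) → WhyCtx s Γ × WhyCtx s Δ
  WhyCtx-++⁻ []      w = Linear.[] , w
  WhyCtx-++⁻ (_ ∷ Γ) (p Linear.∷ w) with WhyCtx-++⁻ Γ w
  ... | v , v′ = p Linear.∷ v , v′

  BangCtx⇒WhyCtx : ∀ {s} → BangCtx s Π → WhyCtx s (trCtxᗮ Π)
  BangCtx⇒WhyCtx Lambek.[] = Linear.[]
  BangCtx⇒WhyCtx {Π = X ∷ Π} (p Lambek.∷ b) =
    subst (WhyCtx _) (sym (trCtxᗮ-++ [ X ] Π))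
      (WhyCtx-++⁺ (BangCtx⇒WhyCtx b) (p Linear.∷ Linear.[]))

  WhyCtx⇒BangCtx : ∀ {s} Π → WhyCtx s (trCtxᗮ Π) → BangCtx s Π
  WhyCtx⇒BangCtx []      _ = Lambek.[]
  WhyCtx⇒BangCtx (X ∷ Π) w with WhyCtx-++⁻ (trCtxᗮ Π) (subst (WhyCtx _) (trCtxᗮ-++ [ X ] Π) w)
  ... | w′ , w₁ with trᗮ X | trᗮ-Trᗮ X | w₁
  ...   | _ | ?ₗ _ _ | p Linear.∷ Linear.[] = p Lambek.∷ WhyCtx⇒BangCtx Π w′

  Decodes : List (LFm n) → Set
  Decodes Γ = ∀ {Π C} → Γ ↻ tr C ∷ trCtxᗮ Π → Π ⇒ C

  ax-decodes : Decodes (A ∷ [ A ᗮ ])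
  ax-decodes {Π = Π} ρ with ↻-pair⁻ ρ
  ... | inj₁ eq with refl , eq′ ← ∷-injective eq with trCtxᗮ-[_]⁻ Π eq′
  ...   | Z , refl , eqZ = subst ([ Z ] ⇒_) (tr-injective (ᗮ-injective eqZ)) Lambek.ax
  ax-decodes {Π = Π} ρ | inj₂ eq with eqC , eq′ ← ∷-injective eq with trCtxᗮ-[_]⁻ Π eq′
  ...   | Z , refl , refl =
    subst ([ Z ] ⇒_) (tr-injective (sym (trans eqC (ᗮ-involutive (tr Z))))) Lambek.ax

  ⊗-decodes : ⊢ (Γ ++ [ A ]) → ⊢ (B ∷ Δ) → Decodes (Γ ++ [ A ]) → Decodes (B ∷ Δ) →
              Decodes (Γ ++ (A ⊗ B) ∷ Δ)
  ⊗-decodes {Γ = Γ} {A = A} {B = B} {Δ = Δ} d₁ d₂ ih₁ ih₂ {Π = Π} {C = C} ρ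
    with focus Π (↻-trans (↻-swap ((A ⊗ B) ∷ Δ) Γ) ρ)
  ... | succedent (x · y) eq with Tr⇒≡ x | Tr⇒≡ y | trCtxᗮ-++⁻ Π Δ Γ (sym eq)
  ...   | refl | refl | Π₁ , Π₂ , refl , refl , refl =
    Lambek.→· {Γ₁ = Π₁} {Γ₂ = Π₂} (ih₁ (↻-swap (trCtxᗮ Π₁) _)) (ih₂ ↻-refl)
  ⊗-decodes {Γ = Γ} {Δ = Δ} d₁ d₂ ih₁ ih₂ {C = C} ρ
    | antecedent Π₁ (X ∖ Y) Π₂ refl (x ∖ y) eq with Tr⇒≡ x | Trᗮ⇒≡ y | split Δ Γ Π₁ Π₂ eq
  ...   | refl | refl | succedent-left Π₂a _ refl refl refl =
    ⊥-elim (⊬-negative d₁ (All.++⁺ (trCtxᗮ-negative Π₂a) ((Y , y) ∷ [])))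
  ...   | refl | refl | succedent-right Π₁a Π₁b refl refl refl =
    subst (_⇒ C) (sym (++-assoc Π₁a Π₁b _))
      (Lambek.∖→ {Π = Π₁b} {Γ₁ = Π₁a} {Γ₂ = Π₂} (ih₂ ↻-refl)
        (ih₁ (↻-trans (↻-swap _ [ trᗮ Y ]) (↻-antecedent Π₁a [ Y ] Π₂ (tr C)))))
  ⊗-decodes {Γ = Γ} {Δ = Δ} d₁ d₂ ih₁ ih₂ {C = C} ρ
    | antecedent Π₁ (X ╱ Y) Π₂ refl (x ╱ y) eq with Trᗮ⇒≡ x | Tr⇒≡ y | split Δ Γ Π₁ Π₂ eq
  ...   | refl | refl | succedent-left Π₂a Π₂b refl refl refl =
    Lambek.╱→ {Π = Π₂a} {Γ₁ = Π₁} {Γ₂ = Π₂b}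
      (ih₁ (↻-swap (trCtxᗮ Π₂a) _)) (ih₂ (↻-antecedent Π₁ [ X ] Π₂b (tr C)))
  ...   | refl | refl | succedent-right _ Π₁b refl refl refl =
    ⊥-elim (⊬-negative d₂ ((X , x) ∷ trCtxᗮ-negative Π₁b))

  ⅋-decodes : Decodes (A ∷ B ∷ Γ) → Decodes ((A ⅋ B) ∷ Γ)
  ⅋-decodes ih {Π = Π} ρ with focus Π ρ
  ... | succedent (x ∖ y) refl with Trᗮ⇒≡ x | Tr⇒≡ y
  ...   | refl | refl = Lambek.→∖ (ih (↻-antecedent [] [ _ ] Π _))
  ⅋-decodes ih {Π = Π} ρ | succedent (x ╱ y) refl with Tr⇒≡ x | Trᗮ⇒≡ y
  ...   | refl | refl = Lambek.→╱ (ih (↻-reflexive (cong (_ ∷_) (sym (trCtxᗮ-++ Π [ _ ])))))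
  ⅋-decodes ih ρ | antecedent Π₁ _ Π₂ refl (x · y) refl with Trᗮ⇒≡ x | Trᗮ⇒≡ y
  ...   | refl | refl = Lambek.·→ {Γ₁ = Π₁} {Γ₂ = Π₂} (ih (↻-antecedent Π₁ (_ ∷ _ ∷ []) Π₂ _))

  &-decodes : Decodes (A ∷ Γ) → Decodes (B ∷ Γ) → Decodes ((A & B) ∷ Γ)
  &-decodes ih₁ ih₂ {Π = Π} ρ with focus Π ρ
  ... | succedent (x ∧ y) refl with Tr⇒≡ x | Tr⇒≡ y
  ...   | refl | refl = Lambek.→∧ (ih₁ ↻-refl) (ih₂ ↻-refl)
  &-decodes ih₁ ih₂ ρ | antecedent Π₁ _ Π₂ refl (x ∨ y) refl with Trᗮ⇒≡ x | Trᗮ⇒≡ y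
  ...   | refl | refl =
    Lambek.∨→ {Γ₁ = Π₁} {Γ₂ = Π₂}
      (ih₁ (↻-antecedent Π₁ [ _ ] Π₂ _)) (ih₂ (↻-antecedent Π₁ [ _ ] Π₂ _))

  ⊕₁-decodes : Decodes (A ∷ Γ) → Decodes ((A ⊕ B) ∷ Γ)
  ⊕₁-decodes ih {Π = Π} ρ with focus Π ρ
  ... | succedent (x ∨ _) refl with refl ← Tr⇒≡ x = Lambek.→∨₁ (ih ↻-refl)
  ... | antecedent Π₁ _ Π₂ refl (x ∧ _) refl with refl ← Trᗮ⇒≡ x =
    Lambek.∧₁→ {Γ₁ = Π₁} {Γ₂ = Π₂} (ih (↻-antecedent Π₁ [ _ ] Π₂ _))

  ⊕₂-decodes : Decodes (B ∷ Γ) → Decodes ((A ⊕ B) ∷ Γ)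
  ⊕₂-decodes ih {Π = Π} ρ with focus Π ρ
  ... | succedent (_ ∨ y) refl with refl ← Tr⇒≡ y = Lambek.→∨₂ (ih ↻-refl)
  ... | antecedent Π₁ _ Π₂ refl (_ ∧ y) refl with refl ← Trᗮ⇒≡ y =
    Lambek.∧₂→ {Γ₁ = Π₁} {Γ₂ = Π₂} (ih (↻-antecedent Π₁ [ _ ] Π₂ _))

  𝟙-decodes : Decodes [ 𝟙 ]
  𝟙-decodes {Π = Π} ρ with focus Π ρ
  ... | succedent 𝟏 eq with refl ← trCtxᗮ-[]⁻ Π (sym eq) = Lambek.→𝟏
  ... | antecedent _ _ _ _ () _

  ⊥-decodes : Decodes Γ → Decodes (⊥ₗ ∷ Γ)
  ⊥-decodes ih {Π = Π} ρ with focus Π ρ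
  ... | succedent () _
  ... | antecedent Π₁ _ Π₂ refl 𝟏 refl =
    Lambek.𝟏→ {Γ₁ = Π₁} {Γ₂ = Π₂} (ih (↻-antecedent Π₁ [] Π₂ _))

  ⊤-decodes : Decodes (⊤ₗ ∷ Γ)
  ⊤-decodes {Π = Π} ρ with focus Π ρ
  ... | succedent () _
  ... | antecedent _ _ _ _ () _

  !-decodes : ∀ {s} → WhyCtx s Γ → Decodes (B ∷ Γ) → Decodes (!ₗ s B ∷ Γ)
  !-decodes w ih {Π = Π} ρ with focus Π ρ
  ... | succedent (! _ x) refl with refl ← Tr⇒≡ x = Lambek.→! (WhyCtx⇒BangCtx Π w) (ih ↻-refl)
  ... | antecedent _ _ _ _ () _

  ?-decodes : ∀ {s} → Decodes (A ∷ Γ) → Decodes (?ₗ s A ∷ Γ)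
  ?-decodes ih {Π = Π} ρ with focus Π ρ
  ... | succedent () _
  ... | antecedent Π₁ _ Π₂ refl (?ₗ _ x) refl with refl ← Trᗮ⇒≡ x =
    Lambek.!→ {Γ₁ = Π₁} {Γ₂ = Π₂} (ih (↻-antecedent Π₁ [ _ ] Π₂ _))

  weak-decodes : ∀ {s} → 𝓦 s → Decodes Γ → Decodes (?ₗ s A ∷ Γ)
  weak-decodes w ih {Π = Π} ρ with focus Π ρ
  ... | succedent () _
  ... | antecedent Π₁ _ Π₂ refl (?ₗ _ _) refl =
    Lambek.weak {Γ₁ = Π₁} {Γ₂ = Π₂} w (ih (↻-antecedent Π₁ [] Π₂ _))

  contr-decodes : ∀ {s} → 𝓒 s → Decodes (?ₗ s A ∷ Γ ++ ?ₗ s A ∷ Δ) → Decodes (?ₗ s A ∷ Γ ++ Δ)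
  contr-decodes {Γ = Γ} {Δ = Δ} c ih {Π = Π} {C = C} ρ with focus Π ρ
  ... | succedent () _
  ... | antecedent Π₁ Z Π₂ refl (?ₗ _ x) eq with Trᗮ⇒≡ x | split Γ Δ Π₁ Π₂ eq
  ...   | refl | succedent-left Π₂a Π₂b refl refl refl =
    Lambek.ncontr₁ {Γ₁ = Π₁} {Δ = Π₂a} {Γ₂ = Π₂b} c (ih (rotation
      (trᗮ Z ∷ trCtxᗮ Π₁) (tr C ∷ trCtxᗮ Π₂b ++ trᗮ Z ∷ trCtxᗮ Π₂a)
      (cong (trᗮ Z ∷_) (++-assoc (trCtxᗮ Π₁) _ _))
      (cong (tr C ∷_) (trans (trCtxᗮ-∷-∷ Π₁ Z Π₂a Z Π₂b) (sym (++-assoc (trCtxᗮ Π₂b) _ _))))))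
  ...   | refl | succedent-right Π₁a Π₁b refl refl refl =
    subst (_⇒ C) (sym (++-assoc Π₁a Π₁b _))
      (Lambek.ncontr₂ {Γ₁ = Π₁a} {Δ = Π₁b} {Γ₂ = Π₂} c (ih (rotation
        (trᗮ Z ∷ trCtxᗮ Π₁b ++ trᗮ Z ∷ trCtxᗮ Π₁a) (tr C ∷ trCtxᗮ Π₂)
        (cong (trᗮ Z ∷_) (sym (++-assoc (trCtxᗮ Π₁b) _ _)))
        (cong (tr C ∷_) (trCtxᗮ-∷-∷ Π₁a Z Π₁b Z Π₂)))))

  ex-decodes : ∀ {s} → 𝓔 s → Decodes (Γ ++ ?ₗ s A ∷ Δ) → Decodes (?ₗ s A ∷ Γ ++ Δ)
  ex-decodes {Γ = Γ} {Δ = Δ} e ih {Π = Π} {C = C} ρ with focus Π ρ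
  ... | succedent () _
  ... | antecedent Π₁ Z Π₂ refl (?ₗ _ x) eq with Trᗮ⇒≡ x | split Γ Δ Π₁ Π₂ eq
  ...   | refl | succedent-left Π₂a Π₂b refl refl refl =
    Lambek.ex₁ {Γ₁ = Π₁} {Δ = Π₂a} {Γ₂ = Π₂b} e (ih (rotation
      (trCtxᗮ Π₁) (tr C ∷ trCtxᗮ Π₂b ++ trᗮ Z ∷ trCtxᗮ Π₂a)
      (++-assoc (trCtxᗮ Π₁) _ _)
      (cong (tr C ∷_) (trans (trCtxᗮ-++-∷ Π₁ Π₂a Z Π₂b) (sym (++-assoc (trCtxᗮ Π₂b) _ _))))))
  ...   | refl | succedent-right Π₁a Π₁b refl refl refl =
    subst (_⇒ C) (sym (++-assoc Π₁a Π₁b _))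
      (Lambek.ex₂ {Γ₁ = Π₁a} {Δ = Π₁b} {Γ₂ = Π₂} e (ih (rotation
        (trCtxᗮ Π₁b ++ trᗮ Z ∷ trCtxᗮ Π₁a) (tr C ∷ trCtxᗮ Π₂)
        (sym (++-assoc (trCtxᗮ Π₁b) _ _))
        (cong (tr C ∷_) (trCtxᗮ-∷-++ Π₁a Z Π₁b Π₂)))))

  decode : ⊢ Γ → Decodes Γ
  decode Linear.ax            = ax-decodes
  decode (Linear.⊗r d₁ d₂)    = ⊗-decodes d₁ d₂ (decode d₁) (decode d₂)
  decode (Linear.⅋r d)        = ⅋-decodes (decode d)
  decode (Linear.&r d₁ d₂)    = &-decodes (decode d₁) (decode d₂)
  decode (Linear.⊕r₁ d)       = ⊕₁-decodes (decode d)
  decode (Linear.⊕r₂ d)       = ⊕₂-decodes (decode d)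
  decode Linear.𝟙r            = 𝟙-decodes
  decode (Linear.⊥r d)        = ⊥-decodes (decode d)
  decode Linear.⊤r            = ⊤-decodes
  decode (Linear.!r w d)      = !-decodes w (decode d)
  decode (Linear.?r d)        = ?-decodes (decode d)
  decode (Linear.weak w d)    = weak-decodes w (decode d)
  decode (Linear.contr c d)   = contr-decodes c (decode d)
  decode (Linear.ex e d)      = ex-decodes e (decode d)
  decode (Linear.rot {Γ₁} {Γ₂} d) ρ = decode d (↻-trans (↻-swap Γ₁ Γ₂) ρ)

  module _ {s : Fin n} {a : LFm n} (Θ Λ Ξ : List (LFm n)) where

    contr-dropˡ : 𝓒 s → ⊢ (Θ ++ ?ₗ s a ∷ Λ ++ ?ₗ s a ∷ Ξ) → ⊢ (Θ ++ Λ ++ ?ₗ s a ∷ Ξ)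
    contr-dropˡ c d =
      ⊢-↻ (rotation (?ₗ s a ∷ Ξ) (Θ ++ Λ) (cong (?ₗ s a ∷_) (++-assoc Ξ Θ Λ)) (sym (++-assoc Θ Λ _)))
        (Linear.contr {Γ = Ξ ++ Θ} {Δ = Λ} c
          (⊢-↻ (rotation (Θ ++ ?ₗ s a ∷ Λ) (?ₗ s a ∷ Ξ) (sym (++-assoc Θ _ _))
                 (cong (?ₗ s a ∷_) (++-assoc Ξ Θ _))) d))

    contr-dropʳ : 𝓒 s → ⊢ (Θ ++ ?ₗ s a ∷ Λ ++ ?ₗ s a ∷ Ξ) → ⊢ (Θ ++ ?ₗ s a ∷ Λ ++ Ξ)
    contr-dropʳ c d =
      ⊢-↻ (rotation (?ₗ s a ∷ Λ ++ Ξ) Θ (cong (?ₗ s a ∷_) (sym (++-assoc Λ Ξ Θ))) refl)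
        (Linear.contr {Γ = Λ} {Δ = Ξ ++ Θ} c
          (⊢-↻ (rotation Θ _ refl (cong (?ₗ s a ∷_) (sym (++-assoc Λ _ Θ)))) d))

    ex-forward : 𝓔 s → ⊢ (Θ ++ Λ ++ ?ₗ s a ∷ Ξ) → ⊢ (Θ ++ ?ₗ s a ∷ Λ ++ Ξ)
    ex-forward e d =
      ⊢-↻ (rotation (?ₗ s a ∷ Λ ++ Ξ) Θ (cong (?ₗ s a ∷_) (sym (++-assoc Λ Ξ Θ))) refl)
        (Linear.ex {Γ = Λ} {Δ = Ξ ++ Θ} e
          (⊢-↻ (rotation Θ _ refl (sym (++-assoc Λ _ Θ))) d))

    ex-backward : 𝓔 s → ⊢ (Θ ++ ?ₗ s a ∷ Λ ++ Ξ) → ⊢ (Θ ++ Λ ++ ?ₗ s a ∷ Ξ)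
    ex-backward e d =
      ⊢-↻ (rotation (?ₗ s a ∷ Ξ) (Θ ++ Λ) (cong (?ₗ s a ∷_) (++-assoc Ξ Θ Λ)) (sym (++-assoc Θ Λ _)))
        (Linear.ex {Γ = Ξ ++ Θ} {Δ = Λ} e
          (⊢-↻ (rotation (Θ ++ ?ₗ s a ∷ Λ) Ξ (sym (++-assoc Θ _ _)) (++-assoc Ξ Θ _)) d))

  under-antecedent : ∀ {C} (Γ₁ M M′ Γ₂ : List (Fm n)) →
                     (∀ {Θ} → ⊢ (trCtxᗮ M ++ Θ) → ⊢ (trCtxᗮ M′ ++ Θ)) →
                     ⊢ (tr C ∷ trCtxᗮ (Γ₁ ++ M ++ Γ₂)) → ⊢ (tr C ∷ trCtxᗮ (Γ₁ ++ M′ ++ Γ₂))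
  under-antecedent Γ₁ M M′ Γ₂ f d =
    ⊢-↻ (↻-antecedent Γ₁ M′ Γ₂ _) (f (⊢-↻ (↻-sym (↻-antecedent Γ₁ M Γ₂ _)) d))

  ⊗-encodes : ⊢ (tr X ∷ trCtxᗮ Π₁) → ⊢ (tr Y ∷ trCtxᗮ Π₂) → ⊢ (tr X ⊗ tr Y ∷ trCtxᗮ (Π₁ ++ Π₂))
  ⊗-encodes {Π₁ = Π₁} {Π₂ = Π₂} d₁ d₂ =
    ⊢-↻ (rotation (trCtxᗮ Π₁) _ refl (cong (_ ∷_) (trCtxᗮ-++ Π₁ Π₂)))
      (Linear.⊗r (⊢-↻ (↻-swap [ _ ] (trCtxᗮ Π₁)) d₁) d₂)

  ∖-encodes : ∀ {Θ} → ⊢ (tr X ∷ trCtxᗮ Π) → ⊢ (trᗮ Y ∷ Θ) → ⊢ (trCtxᗮ (Π ++ [ X ∖ Y ]) ++ Θ)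
  ∖-encodes {X = X} {Π = Π} {Y = Y} {Θ = Θ} d₁ d₂ =
    subst (λ Γ → ⊢ (Γ ++ Θ)) (sym (trCtxᗮ-++ Π [ X ∖ Y ]))
      (⊢-↻ (↻-swap Θ _)
        (Linear.⊗r (⊢-↻ (↻-swap [ _ ] Θ) d₂)
                   (subst (λ A → ⊢ (A ∷ trCtxᗮ Π)) (sym (ᗮ-involutive (tr X))) d₁)))

  ╱-encodes : ∀ {Θ} → ⊢ (tr Y ∷ trCtxᗮ Π) → ⊢ (trᗮ X ∷ Θ) → ⊢ (trCtxᗮ ((X ╱ Y) ∷ Π) ++ Θ)
  ╱-encodes {Y = Y} {Π = Π} {X = X} {Θ = Θ} d₁ d₂ =
    subst ⊢_ (sym (trans (cong (_++ Θ) (trCtxᗮ-++ [ X ╱ Y ] Π)) (++-assoc (trCtxᗮ Π) _ Θ)))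
      (Linear.⊗r (subst (λ A → ⊢ (trCtxᗮ Π ++ [ A ])) (sym (ᗮ-involutive (tr Y)))
                        (⊢-↻ (↻-swap [ _ ] _) d₁))
                 d₂)

  ⊢-tail : Γ ≡ Δ → ⊢ (A ∷ Γ) → ⊢ (A ∷ Δ)
  ⊢-tail refl d = d

  encode : Π ⇒ C → ⊢ (tr C ∷ trCtxᗮ Π)
  encode Lambek.ax = Linear.ax
  encode Lambek.→𝟏 = Linear.𝟙r
  encode (Lambek.·→ {Γ₁} {Γ₂} {A} {B} d) =
    under-antecedent Γ₁ (A ∷ B ∷ []) [ A · B ] Γ₂ Linear.⅋r (encode d)
  encode (Lambek.→· {Γ₁} {Γ₂} d₁ d₂) = ⊗-encodes {Π₁ = Γ₁} {Π₂ = Γ₂} (encode d₁) (encode d₂)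
  encode (Lambek.∖→ {Π} {Γ₁} {Γ₂} {A} {B} {C} d₁ d₂) =
    subst (λ Δ → ⊢ (tr C ∷ trCtxᗮ (Γ₁ ++ Δ))) (++-assoc Π [ A ∖ B ] Γ₂)
      (under-antecedent Γ₁ [ B ] (Π ++ [ A ∖ B ]) Γ₂ (∖-encodes {Π = Π} (encode d₁)) (encode d₂))
  encode (Lambek.→∖ {Π} {A} d) = Linear.⅋r (⊢-↻ (↻-sym (↻-antecedent [] [ A ] Π _)) (encode d))
  encode (Lambek.╱→ {Π} {Γ₁} {Γ₂} {A} {B} d₁ d₂) =
    under-antecedent Γ₁ [ B ] ((B ╱ A) ∷ Π) Γ₂ (╱-encodes {Π = Π} (encode d₁)) (encode d₂)
  encode (Lambek.→╱ {Π} {A} {B} d) =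
    Linear.⅋r (⊢-tail (trCtxᗮ-++ Π [ A ]) (encode d))
  encode (Lambek.𝟏→ {Γ₁} {Γ₂} d) = under-antecedent Γ₁ [] [ 𝟏 ] Γ₂ Linear.⊥r (encode d)
  encode (Lambek.∨→ {Γ₁} {Γ₂} {A₁} {A₂} d₁ d₂) =
    ⊢-↻ (↻-antecedent Γ₁ [ A₁ ∨ A₂ ] Γ₂ _)
      (Linear.&r (⊢-↻ (↻-sym (↻-antecedent Γ₁ [ A₁ ] Γ₂ _)) (encode d₁))
                 (⊢-↻ (↻-sym (↻-antecedent Γ₁ [ A₂ ] Γ₂ _)) (encode d₂)))
  encode (Lambek.→∨₁ d) = Linear.⊕r₁ (encode d)
  encode (Lambek.→∨₂ d) = Linear.⊕r₂ (encode d)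
  encode (Lambek.∧₁→ {Γ₁} {Γ₂} {A₁} {A₂} d) =
    under-antecedent Γ₁ [ A₁ ] [ A₁ ∧ A₂ ] Γ₂ Linear.⊕r₁ (encode d)
  encode (Lambek.∧₂→ {Γ₁} {Γ₂} {A₁} {A₂} d) =
    under-antecedent Γ₁ [ A₂ ] [ A₁ ∧ A₂ ] Γ₂ Linear.⊕r₂ (encode d)
  encode (Lambek.→∧ d₁ d₂) = Linear.&r (encode d₁) (encode d₂)
  encode (Lambek.!→ {Γ₁} {Γ₂} {s} {A} d) =
    under-antecedent Γ₁ [ A ] [ ! s A ] Γ₂ Linear.?r (encode d)
  encode (Lambek.→! b d) = Linear.!r (BangCtx⇒WhyCtx b) (encode d)
  encode (Lambek.weak {Γ₁} {Γ₂} {s} {A} w d) =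
    under-antecedent Γ₁ [] [ ! s A ] Γ₂ (Linear.weak w) (encode d)
  encode (Lambek.ncontr₁ {Γ₁} {Δ} {Γ₂} {s} {A} {C} c d) =
    ⊢-tail (sym (trCtxᗮ-∷-++ Γ₁ (! s A) Δ Γ₂))
      (contr-dropˡ (tr C ∷ trCtxᗮ Γ₂) (trCtxᗮ Δ) (trCtxᗮ Γ₁) c
        (⊢-tail (trCtxᗮ-∷-∷ Γ₁ (! s A) Δ (! s A) Γ₂) (encode d)))
  encode (Lambek.ncontr₂ {Γ₁} {Δ} {Γ₂} {s} {A} {C} c d) =
    ⊢-tail (sym (trCtxᗮ-++-∷ Γ₁ Δ (! s A) Γ₂))
      (contr-dropʳ (tr C ∷ trCtxᗮ Γ₂) (trCtxᗮ Δ) (trCtxᗮ Γ₁) c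
        (⊢-tail (trCtxᗮ-∷-∷ Γ₁ (! s A) Δ (! s A) Γ₂) (encode d)))
  encode (Lambek.ex₁ {Γ₁} {Δ} {Γ₂} {s} {A} {C} e d) =
    ⊢-tail (sym (trCtxᗮ-∷-++ Γ₁ (! s A) Δ Γ₂))
      (ex-backward (tr C ∷ trCtxᗮ Γ₂) (trCtxᗮ Δ) (trCtxᗮ Γ₁) e
        (⊢-tail (trCtxᗮ-++-∷ Γ₁ Δ (! s A) Γ₂) (encode d)))
  encode (Lambek.ex₂ {Γ₁} {Δ} {Γ₂} {s} {A} {C} e d) =
    ⊢-tail (sym (trCtxᗮ-++-∷ Γ₁ Δ (! s A) Γ₂))
      (ex-forward (tr C ∷ trCtxᗮ Γ₂) (trCtxᗮ Δ) (trCtxᗮ Γ₁) e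
        (⊢-tail (trCtxᗮ-∷-++ Γ₁ (! s A) Δ Γ₂) (encode d)))

corollary2 : (S : SubexpSig) (Π : List (Fm (SubexpSig.n S))) (B : Fm (SubexpSig.n S)) → (SMALC._⇒_ S Π B → SCLL.⊢_ S (trCtxᗮ Π ++ [ tr B ])) × (SCLL.⊢_ S (trCtxᗮ Π ++ [ tr B ]) → SMALC._⇒_ S Π B)
corollary2 S Π B =
  (λ d → ⊢-↻ S (↻-swap [ tr B ] (trCtxᗮ Π)) (encode S d)) ,
  (λ d → decode S d (↻-swap (trCtxᗮ Π) [ tr B ]))
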